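{- Let $\mathcal L_1$ and $\mathcal L_2$ be sound matrix logics and let $\mathcal L_1\mathcal L_2$ be their meet-combination. Then $\not\vdash_{12}\bot_k$ for each $k=1,2$, and $\not\vdash_{12}\xi$ for each schema variable $\xi\in\Xi$.
   Context: A matrix logic is a triple $\mathcal L=(\Sigma,\Delta,\mathcal M)$: $\Sigma=\{\Sigma_n\}_{n\in\mathbb N}$ with $\Sigma_n$ a set of $n$-ary constructors; $L(\Xi)$ is the set of formulas over $\Sigma$ and the schema variables $\Xi=\{\xi_k:k\in\mathbb N\}$; $\Delta$ is a set of finitary rules $\alpha_1\dots\alpha_m/\beta$ (rules with no premises are axioms); $\Gamma\vdash\varphi$ means there is a sequence $\varphi_1,\dots,\varphi_n=\varphi$ each member of which is in $\Gamma$ or is the conclusion of a substitution instance of a rule of $\Delta$ whose premises occur earlier; $\vdash\varphi$ means $\emptyset\vdash\varphi$. $\mathcal M$ is a nonempty class of matrices $(\mathfrak A,D)$ with $\mathfrak A$ a $\Sigma$-algebra and $D$ a nonempty subset of its carrier; $\Gamma\models\varphi$ means that for every matrix of $\mathcal M$ and assignment of carrier elements to the schema variables, if every formula of $\Gamma$ denotes an element of $D$ then so does $\varphi$. $\mathcal L$ is sound if $\Gamma\vdash\varphi$ implies $\Gamma\models\varphi$. Standing assumptions on every logic: $\top,\bot\in\Sigma_0$, $\vdash\top$, $\bot\vdash\varphi$ for every $\varphi$, in every matrix $\top$ denotes a distinguished value and $\bot$ does not; for each $n\ge1$ there is $\top^n\in\Sigma_n$ with $\top^n(\varphi_1,\dots,\varphi_n)$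 equivalent to $\top$. Meet-combination $\mathcal L_1\mathcal L_2=(\Sigma_{12},\Delta_{12},\mathcal M_{12})$ of $\mathcal L_1=(\Sigma_1,\Delta_1,\mathcal M_1)$ and $\mathcal L_2=(\Sigma_2,\Delta_2,\mathcal M_2)$: $\Sigma_{12,n}=\{(c_1c_2):c_1\in\Sigma_{1n},c_2\in\Sigma_{2n}\}$, formulas $L_{12}(\Xi)$. Each $c_1\in\Sigma_{1n}$ is identified with $(c_1\top^n_2)$ and each $c_2\in\Sigma_{2n}$ with $(\top^n_1c_2)$ (for $n=0$, $\top^0$ means $\top$), so $L_k(\Xi)\subseteq L_{12}(\Xi)$; in particular $\bot_1$ stands for $(\bot_1\top_2)$ and $\bot_2$ for $(\top_1\bot_2)$. The projection $|\varphi|_k$ replaces each combined constructor by its $k$-th component. Tagging of a rule $r=\alpha_1\dots\alpha_m/\beta$ of $\mathcal L_k$: if $\beta$ is not a schema variable, $\overline r=\{r\}$; if $\beta$ is a schema variable, $\overline r$ consists, for each $n$ and each $c\in\Sigma_{kn}$, of the rule $\rho_{r,c}(\alpha_1)\dots\rho_{r,c}(\alpha_m)/\rho_{r,c}(\beta)$ where $\rho_{r,c}(\beta)=c(\xi_{j+1},\dots,\xi_{j+n})$, $j$ the maximum index of schema variables occurring in $r$, and $\rho_{r,c}$ fixes all other variables. $\Delta_{12}$ consists of: all rules in $\overline{\Delta_1}\cup\overline{\Delta_2}$ (via the identifications); the lifting rules $|\varphi|_1\ |\varphi|_2/\varphi$ and co-lifting rules $\varphi/|\varphi|_k$ ($k=1,2$)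 for every $\varphi\in L_{12}(\Xi)$; and $\bot_1/\bot_2$, $\bot_2/\bot_1$. $\mathcal M_{12}$ is the class of product matrices $(\mathfrak A_1\times\mathfrak A_2,D_1\times D_2)$ for $(\mathfrak A_k,D_k)\in\mathcal M_k$, with $(c_1c_2)$ interpreted componentwise. $\vdash_{12}$ denotes derivability in $\mathcal L_1\mathcal L_2$. -}

module Defs where

open import Data.Nat using (ℕ; zero; suc; _+_; _⊔_; _≟_)
open import Data.Fin using (Fin; toℕ)
open import Data.Vec using (Vec; []; _∷_; tabulate)
open import Data.List using (List; []; _∷_; map)
open import Data.List.Membership.Propositional using (_∈_)
open import Data.List.Relation.Unary.All using (All)
open import Data.Product using (Σ; ∃; _×_; _,_)
open import Data.Sum using (_⊎_)
open import Data.Empty using (⊥)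
open import Relation.Nullary using (¬_; yes; no)
open import Relation.Binary.PropositionalEquality using (_≡_)

-- A signature: Sig n is the set of n-ary constructors.
Sig : Set₁
Sig = ℕ → Set

data Form (S : Sig) : Set where
  var : ℕ → Form S
  app : ∀ {n} → S n → Vec (Form S) n → Form S

mutual
  sub : ∀ {S} → (ℕ → Form S) → Form S → Form S
  sub σ (var i)    = σ i
  sub σ (app c φs) = app c (subs σ φs)

  subs : ∀ {S n} → (ℕ → Form S) → Vec (Form S) n → Vec (Form S) n
  subs σ []       = []
  subs σ (φ ∷ φs) = sub σ φ ∷ subs σ φs

-- Maximum index of a schema variable occurring in a formula (0 if none)
mutual
  maxVar : ∀ {S} → Form S → ℕ
  maxVar (var i)    = i
  maxVar (app c φs) = maxVars φs

  maxVars : ∀ {S n} → Vec (Form S) n → ℕ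
  maxVars []       = 0
  maxVars (φ ∷ φs) = maxVar φ ⊔ maxVars φs

-- A finitary rule α₁ … αₘ / β  (m = 0 : axiom)
record Rule (S : Sig) : Set where
  constructor _/_
  field
    premises : List (Form S)
    conclusion : Form S
open Rule public

FSet : Sig → Set₁
FSet S = Form S → Set

RSet : Sig → Set₁
RSet S = Rule S → Set

∅ : ∀ {S} → FSet S
∅ _ = ⊥

｛_｝ : ∀ {S} → Form S → FSet S
｛ φ ｝ ψ = ψ ≡ φ

Justified : ∀ {S} → RSet S → FSet S → List (Form S) → Form S → Set
Justified {S} Δ Γ prev φ =
  Γ φ ⊎ (Σ (Rule S) λ r → Δ r × Σ (ℕ → Form S) λ σ →
           (sub σ (conclusion r) ≡ φ) ×
           All (λ α → sub σ α ∈ prev) (premises r))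

-- A valid derivation sequence, stored in REVERSE order
-- (head = latest member).
ValidSeq : ∀ {S} → RSet S → FSet S → List (Form S) → Set
ValidSeq Δ Γ []         = Data.Unit.⊤ where import Data.Unit
ValidSeq Δ Γ (φ ∷ prev) = ValidSeq Δ Γ prev × Justified Δ Γ prev φ

Derives : ∀ {S} → RSet S → FSet S → Form S → Set
Derives {S} Δ Γ φ = Σ (List (Form S)) λ prev → ValidSeq Δ Γ (φ ∷ prev)

record Matrix (S : Sig) : Set₁ where
  field
    Carrier : Set
    op : ∀ {n} → S n → Vec Carrier n → Carrier
    D : Carrier → Set
    D-nonempty : ∃ D

module _ {S : Sig} (M : Matrix S) where
  open Matrix M
  mutual
    ⟦_⟧ : Form S → (ℕ → Carrier) → Carrier
    ⟦ var i ⟧ ρ    = ρ i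
    ⟦ app c φs ⟧ ρ = op c (⟦ φs ⟧s ρ)

    ⟦_⟧s : ∀ {n} → Vec (Form S) n → (ℕ → Carrier) → Vec Carrier n
    ⟦ [] ⟧s ρ     = []
    ⟦ φ ∷ φs ⟧s ρ = ⟦ φ ⟧ ρ ∷ ⟦ φs ⟧s ρ

Entails : ∀ {S} → (Matrix S → Set) → FSet S → Form S → Set₁
Entails {S} 𝓜 Γ φ =
  (M : Matrix S) → 𝓜 M → (ρ : ℕ → Matrix.Carrier M) →
  ((ψ : Form S) → Γ ψ → Matrix.D M (⟦ M ⟧ ψ ρ)) →
  Matrix.D M (⟦ M ⟧ φ ρ)

topPow : ∀ {S : Sig} → S 0 → ((n : ℕ) → S (suc n)) → (n : ℕ) → S n
topPow t ts zero    = t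
topPow t ts (suc n) = ts n

record Logic : Set₂ where
  field
    Σc : Sig
    Δ : RSet Σc
    𝓜 : Matrix Σc → Set
    𝓜-nonempty : Σ (Matrix Σc) 𝓜
    ⊤c ⊥c : Σc 0
    ⊤suc : (n : ℕ) → Σc (suc n)
    ⊢⊤ : Derives Δ ∅ (app ⊤c [])
    ⊥⊢ : (φ : Form Σc) → Derives Δ ｛ app ⊥c [] ｝ φ
    ⊤-dist : (M : Matrix Σc) → 𝓜 M → Matrix.D M (Matrix.op M ⊤c [])
    ⊥-undist : (M : Matrix Σc) → 𝓜 M → ¬ Matrix.D M (Matrix.op M ⊥c [])
    ⊤ⁿ⊢⊤ : (n : ℕ) (φs : Vec (Form Σc) (suc n)) →
           Derives Δ ｛ app (⊤suc n) φs ｝ (app ⊤c [])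
    ⊤⊢⊤ⁿ : (n : ℕ) (φs : Vec (Form Σc) (suc n)) →
           Derives Δ ｛ app ⊤c [] ｝ (app (⊤suc n) φs)
  ⊤f ⊥f : Form Σc
  ⊤f = app ⊤c []
  ⊥f = app ⊥c []
  ⊤^ : (n : ℕ) → Σc n
  ⊤^ = topPow ⊤c ⊤suc

Sound : Logic → Set₁
Sound L = (Γ : FSet Σc) (φ : Form Σc) → Derives Δ Γ φ → Entails 𝓜 Γ φ
  where open Logic L

module MeetCombination (L₁ L₂ : Logic) where
  private
    module L₁ = Logic L₁
    module L₂ = Logic L₂

  Σ₁₂ : Sig
  Σ₁₂ n = L₁.Σc n × L₂.Σc n

  mutual
    emb₁ : Form L₁.Σc → Form Σ₁₂
    emb₁ (var i)            = var i
    emb₁ (app {n} c φs)     = app (c , L₂.⊤^ n) (embs₁ φs)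

    embs₁ : ∀ {n} → Vec (Form L₁.Σc) n → Vec (Form Σ₁₂) n
    embs₁ []       = []
    embs₁ (φ ∷ φs) = emb₁ φ ∷ embs₁ φs

  mutual
    emb₂ : Form L₂.Σc → Form Σ₁₂
    emb₂ (var i)            = var i
    emb₂ (app {n} c φs)     = app (L₁.⊤^ n , c) (embs₂ φs)

    embs₂ : ∀ {n} → Vec (Form L₂.Σc) n → Vec (Form Σ₁₂) n
    embs₂ []       = []
    embs₂ (φ ∷ φs) = emb₂ φ ∷ embs₂ φs

  embRule₁ : Rule L₁.Σc → Rule Σ₁₂
  embRule₁ (αs / β) = map emb₁ αs / emb₁ β

  embRule₂ : Rule L₂.Σc → Rule Σ₁₂
  embRule₂ (αs / β) = map emb₂ αs / emb₂ β

  mutual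
    proj₁ : Form Σ₁₂ → Form L₁.Σc
    proj₁ (var i)             = var i
    proj₁ (app (c₁ , c₂) φs)  = app c₁ (projs₁ φs)

    projs₁ : ∀ {n} → Vec (Form Σ₁₂) n → Vec (Form L₁.Σc) n
    projs₁ []       = []
    projs₁ (φ ∷ φs) = proj₁ φ ∷ projs₁ φs

  mutual
    proj₂ : Form Σ₁₂ → Form L₂.Σc
    proj₂ (var i)             = var i
    proj₂ (app (c₁ , c₂) φs)  = app c₂ (projs₂ φs)

    projs₂ : ∀ {n} → Vec (Form Σ₁₂) n → Vec (Form L₂.Σc) n
    projs₂ []       = []
    projs₂ (φ ∷ φs) = proj₂ φ ∷ projs₂ φs

  ⊥₁ ⊥₂ : Form Σ₁₂
  ⊥₁ = emb₁ L₁.⊥f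
  ⊥₂ = emb₂ L₂.⊥f

-- For a rule r whose conclusion is
-- the schema variable ξ_i, and c ∈ S n, ρ_{r,c} maps ξ_i to
-- c(ξ_{j+1},…,ξ_{j+n}) (j the maximum variable index of r) and fixes
-- every other variable.
maxVarRule : ∀ {S} → Rule S → ℕ
maxVarRule (αs / β) = Data.List.foldr (λ α m → maxVar α ⊔ m) (maxVar β) αs

ρ-tag : ∀ {S n} → Rule S → ℕ → S n → ℕ → Form S
ρ-tag {n = n} r i c k with k ≟ i
... | yes _ = app c (tabulate (λ (l : Fin n) → var (maxVarRule r + suc (toℕ l))))
... | no _  = var k

tagRule : ∀ {S n} → Rule S → ℕ → S n → Rule S
tagRule r i c = map (sub (ρ-tag r i c)) (premises r) / sub (ρ-tag r i c) (conclusion r)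

data Tagged {S : Sig} (Δ : RSet S) : Rule S → Set where
  untagged : ∀ {αs β} → Δ (αs / β) → (∀ i → ¬ β ≡ var i) → Tagged Δ (αs / β)
  tagged : ∀ {αs i n} (c : S n) → Δ (αs / var i) →
           Tagged Δ (tagRule (αs / var i) i c)

module MeetCombinationRules (L₁ L₂ : Logic) where
  open MeetCombination L₁ L₂
  private
    module L₁ = Logic L₁
    module L₂ = Logic L₂

  data Δ₁₂ : Rule Σ₁₂ → Set where
    from₁ : ∀ {r} → Tagged L₁.Δ r → Δ₁₂ (embRule₁ r)
    from₂ : ∀ {r} → Tagged L₂.Δ r → Δ₁₂ (embRule₂ r)
    lift : (φ : Form Σ₁₂) →
           Δ₁₂ ((emb₁ (proj₁ φ) ∷ emb₂ (proj₂ φ) ∷ []) / φ)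
    colift₁ : (φ : Form Σ₁₂) → Δ₁₂ ((φ ∷ []) / emb₁ (proj₁ φ))
    colift₂ : (φ : Form Σ₁₂) → Δ₁₂ ((φ ∷ []) / emb₂ (proj₂ φ))
    ⊥₁/⊥₂ : Δ₁₂ ((⊥₁ ∷ []) / ⊥₂)
    ⊥₂/⊥₁ : Δ₁₂ ((⊥₂ ∷ []) / ⊥₁)

  _⊢₁₂_ : FSet Σ₁₂ → Form Σ₁₂ → Set
  Γ ⊢₁₂ φ = Derives Δ₁₂ Γ φ

-- Soundness of the meet-combination with respect to product matrices: fix matrices of
-- L₁ and L₂ with valuations, and say a combined formula holds when both its projections are
-- designated.  Every rule of the combination preserves this.  A tagged rule of Lₖ is a
-- substitution instance of a sound rule in component k, and since tagging ensures its
-- conclusion is a constructor application, the embedding puts ⊤ⁿ in the other component.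
-- Lifting and co-lifting merely pass between a formula and its projections, and the
-- premise of a ⊥-transfer rule never holds.  Valuating every schema variable at ⊥ then
-- refutes ⊥₁, ⊥₂ and each ξ.
module Submission where

open import Defs
open import Function using (_∘_; const)
open import Data.Nat using (ℕ; zero; suc; _≟_)
open import Data.Product as Product using (_×_; _,_)
open import Data.Sum using (inj₁; inj₂)
open import Data.Empty using (⊥-elim)
open import Data.Unit using (tt)
open import Data.Vec using (Vec; []; _∷_)
open import Data.List using (List; []; _∷_; map)
open import Data.List.Relation.Unary.All as All using (All; []; _∷_)
open import Data.List.Relation.Unary.All.Properties using (map⁺; map⁻)
open import Data.List.Relation.Unary.Any using (here; there)
open import Data.List.Membership.Propositional using (_∈_)
open import Data.List.Membership.Propositional.Properties using (∈-map⁺)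
open import Relation.Nullary using (¬_; yes; no)
open import Relation.Unary using (_⊆_)
open import Relation.Binary.PropositionalEquality
  using (_≡_; refl; sym; trans; cong; cong₂; subst)

mutual
  sub-sub : ∀ {S} (σ τ : ℕ → Form S) (φ : Form S) →
            sub σ (sub τ φ) ≡ sub (sub σ ∘ τ) φ
  sub-sub σ τ (var i)    = refl
  sub-sub σ τ (app c φs) = cong (app c) (subs-subs σ τ φs)

  subs-subs : ∀ {S n} (σ τ : ℕ → Form S) (φs : Vec (Form S) n) →
              subs σ (subs τ φs) ≡ subs (sub σ ∘ τ) φs
  subs-subs σ τ []       = refl
  subs-subs σ τ (φ ∷ φs) = cong₂ _∷_ (sub-sub σ τ φ) (subs-subs σ τ φs)

data IsApp {S : Sig} : Form S → Set where
  app : ∀ {n} (c : S n) (φs : Vec (Form S) n) → IsApp (app c φs)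

module _ {S : Sig} where

  Preserves : (Form S → Set) → Rule S → Set
  Preserves P r = ∀ σ → All (P ∘ sub σ) (premises r) → P (sub σ (conclusion r))

  instance-preserves : ∀ {P} (r : Rule S) τ → Preserves P r →
                       Preserves P (map (sub τ) (premises r) / sub τ (conclusion r))
  instance-preserves {P} (αs / β) τ pres σ hs =
    subst P (sym (sub-sub σ τ β))
      (pres (sub σ ∘ τ) (All.map (λ {α} → subst P (sub-sub σ τ α)) (map⁻ hs)))

  Tagged-preserves : ∀ {Δ : RSet S} {P} → (∀ {r} → Δ r → Preserves P r) →
                     ∀ {r} → Tagged Δ r → Preserves P r
  Tagged-preserves         pres (untagged d _) = pres d
  Tagged-preserves {P = P} pres (tagged c d) = instance-preserves {P} _ _ (pres d)

  Tagged-conclusion-isApp : ∀ {Δ : RSet S} {r} → Tagged Δ r → IsApp (conclusion r)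
  Tagged-conclusion-isApp (untagged {β = var i} _ β≢var) = ⊥-elim (β≢var i refl)
  Tagged-conclusion-isApp (untagged {β = app c φs} _ _)  = app c φs
  Tagged-conclusion-isApp (tagged {i = i} c _) with i ≟ i
  ... | yes _  = app c _
  ... | no i≢i = ⊥-elim (i≢i refl)

  ValidSeq-mono : ∀ {Δ : RSet S} {Γ Γ′ : FSet S} → Γ ⊆ Γ′ →
                  ∀ {φs} → ValidSeq Δ Γ φs → ValidSeq Δ Γ′ φs
  ValidSeq-mono Γ⊆Γ′ {[]}     _             = tt
  ValidSeq-mono Γ⊆Γ′ {φ ∷ φs} (v , inj₁ γ)  = ValidSeq-mono Γ⊆Γ′ v , inj₁ (Γ⊆Γ′ γ)
  ValidSeq-mono Γ⊆Γ′ {φ ∷ φs} (v , inj₂ ru) = ValidSeq-mono Γ⊆Γ′ v , inj₂ ru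

  hypotheses-valid : ∀ {Δ : RSet S} (φs : List (Form S)) → ValidSeq Δ (_∈ φs) φs
  hypotheses-valid []       = tt
  hypotheses-valid (φ ∷ φs) = ValidSeq-mono there (hypotheses-valid φs) , inj₁ (here refl)

  rule-instance-derivable : ∀ {Δ : RSet S} {r} → Δ r → ∀ σ →
                            Derives Δ (_∈ map (sub σ) (premises r)) (sub σ (conclusion r))
  rule-instance-derivable {r = r} d σ =
    prev , hypotheses-valid prev , inj₂ (r , d , σ , refl , All.tabulate (∈-map⁺ (sub σ)))
    where prev = map (sub σ) (premises r)

  derivable-preserves : ∀ {Δ : RSet S} {Γ P : FSet S} →
                        (∀ {r} → Δ r → Preserves P r) → Γ ⊆ P →
                        ∀ {φ} → Derives Δ Γ φ → P φ
  derivable-preserves {Δ} {Γ} {P} pres Γ⊆P (prev , v) = All.head (valid-all _ v)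
    where
    valid-all : ∀ φs → ValidSeq Δ Γ φs → All P φs
    valid-all []       _ = []
    valid-all (φ ∷ φs) (v , inj₁ γ) = Γ⊆P γ ∷ valid-all φs v
    valid-all (φ ∷ φs) (v , inj₂ (r , d , σ , refl , σαs∈)) =
      pres d σ (All.map (All.lookup earlier) σαs∈) ∷ earlier
      where earlier = valid-all φs v

module SoundLogic (L : Logic) (sound : Sound L)
                  {M : Matrix (Logic.Σc L)} (m : Logic.𝓜 L M)
                  (ρ : ℕ → Matrix.Carrier M) where
  open Logic L
  open Matrix M

  Designated : Form Σc → Set
  Designated φ = D (⟦ M ⟧ φ ρ)

  rule-preserves : ∀ {r} → Δ r → Preserves Designated r
  rule-preserves d σ hs =
    sound _ _ (rule-instance-derivable d σ) M m ρ (λ _ → All.lookup (map⁺ hs))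

  ⊤^-designated : ∀ n (φs : Vec (Form Σc) n) → Designated (app (⊤^ n) φs)
  ⊤^-designated zero    []  = ⊤-dist M m
  ⊤^-designated (suc n) φs  =
    sound _ _ (⊤⊢⊤ⁿ n φs) M m ρ (λ { _ refl → ⊤-dist M m })

module MeetCombinationSoundness (L₁ L₂ : Logic) where
  open MeetCombination L₁ L₂
  open MeetCombinationRules L₁ L₂
  private
    module L₁ = Logic L₁
    module L₂ = Logic L₂

  mutual
    proj₁-emb₁ : ∀ φ → proj₁ (emb₁ φ) ≡ φ
    proj₁-emb₁ (var i)    = refl
    proj₁-emb₁ (app c φs) = cong (app c) (projs₁-embs₁ φs)

    projs₁-embs₁ : ∀ {n} (φs : Vec (Form L₁.Σc) n) → projs₁ (embs₁ φs) ≡ φs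
    projs₁-embs₁ []       = refl
    projs₁-embs₁ (φ ∷ φs) = cong₂ _∷_ (proj₁-emb₁ φ) (projs₁-embs₁ φs)

  mutual
    proj₂-emb₂ : ∀ φ → proj₂ (emb₂ φ) ≡ φ
    proj₂-emb₂ (var i)    = refl
    proj₂-emb₂ (app c φs) = cong (app c) (projs₂-embs₂ φs)

    projs₂-embs₂ : ∀ {n} (φs : Vec (Form L₂.Σc) n) → projs₂ (embs₂ φs) ≡ φs
    projs₂-embs₂ []       = refl
    projs₂-embs₂ (φ ∷ φs) = cong₂ _∷_ (proj₂-emb₂ φ) (projs₂-embs₂ φs)

  mutual
    proj₁-sub : ∀ σ φ → proj₁ (sub σ φ) ≡ sub (proj₁ ∘ σ) (proj₁ φ)
    proj₁-sub σ (var i)          = refl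
    proj₁-sub σ (app (c , _) φs) = cong (app c) (projs₁-subs σ φs)

    projs₁-subs : ∀ {n} σ (φs : Vec (Form Σ₁₂) n) →
                  projs₁ (subs σ φs) ≡ subs (proj₁ ∘ σ) (projs₁ φs)
    projs₁-subs σ []       = refl
    projs₁-subs σ (φ ∷ φs) = cong₂ _∷_ (proj₁-sub σ φ) (projs₁-subs σ φs)

  mutual
    proj₂-sub : ∀ σ φ → proj₂ (sub σ φ) ≡ sub (proj₂ ∘ σ) (proj₂ φ)
    proj₂-sub σ (var i)          = refl
    proj₂-sub σ (app (_ , c) φs) = cong (app c) (projs₂-subs σ φs)

    projs₂-subs : ∀ {n} σ (φs : Vec (Form Σ₁₂) n) →
                  projs₂ (subs σ φs) ≡ subs (proj₂ ∘ σ) (projs₂ φs)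
    projs₂-subs σ []       = refl
    projs₂-subs σ (φ ∷ φs) = cong₂ _∷_ (proj₂-sub σ φ) (projs₂-subs σ φs)

  proj₁-sub-emb₁ : ∀ σ φ → proj₁ (sub σ (emb₁ φ)) ≡ sub (proj₁ ∘ σ) φ
  proj₁-sub-emb₁ σ φ = trans (proj₁-sub σ (emb₁ φ)) (cong (sub (proj₁ ∘ σ)) (proj₁-emb₁ φ))

  proj₂-sub-emb₂ : ∀ σ φ → proj₂ (sub σ (emb₂ φ)) ≡ sub (proj₂ ∘ σ) φ
  proj₂-sub-emb₂ σ φ = trans (proj₂-sub σ (emb₂ φ)) (cong (sub (proj₂ ∘ σ)) (proj₂-emb₂ φ))

  proj₁-sub-emb₁-proj₁ : ∀ σ φ → proj₁ (sub σ (emb₁ (proj₁ φ))) ≡ proj₁ (sub σ φ)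
  proj₁-sub-emb₁-proj₁ σ φ = trans (proj₁-sub-emb₁ σ (proj₁ φ)) (sym (proj₁-sub σ φ))

  proj₂-sub-emb₂-proj₂ : ∀ σ φ → proj₂ (sub σ (emb₂ (proj₂ φ))) ≡ proj₂ (sub σ φ)
  proj₂-sub-emb₂-proj₂ σ φ = trans (proj₂-sub-emb₂ σ (proj₂ φ)) (sym (proj₂-sub σ φ))

  module Semantics (sound₁ : Sound L₁) (sound₂ : Sound L₂)
           {M₁ : Matrix L₁.Σc} (m₁ : L₁.𝓜 M₁) {M₂ : Matrix L₂.Σc} (m₂ : L₂.𝓜 M₂)
           (ρ₁ : ℕ → Matrix.Carrier M₁) (ρ₂ : ℕ → Matrix.Carrier M₂) where
    private
      module S₁ = SoundLogic L₁ sound₁ m₁ ρ₁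
      module S₂ = SoundLogic L₂ sound₂ m₂ ρ₂

    Holds₁ Holds₂ Holds : Form Σ₁₂ → Set
    Holds₁ = S₁.Designated ∘ proj₁
    Holds₂ = S₂.Designated ∘ proj₂
    -- Designation in the product matrix (M₁ × M₂, D₁ × D₂) under the valuation ⟨ρ₁, ρ₂⟩.
    Holds φ = Holds₁ φ × Holds₂ φ

    embRule₁-preserves : ∀ {r} → Preserves S₁.Designated r → Preserves Holds₁ (embRule₁ r)
    embRule₁-preserves {r} pres σ hs =
      subst S₁.Designated (sym (proj₁-sub-emb₁ σ (conclusion r)))
        (pres (proj₁ ∘ σ)
          (All.map (λ {α} → subst S₁.Designated (proj₁-sub-emb₁ σ α)) (map⁻ hs)))

    embRule₂-preserves : ∀ {r} → Preserves S₂.Designated r → Preserves Holds₂ (embRule₂ r)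
    embRule₂-preserves {r} pres σ hs =
      subst S₂.Designated (sym (proj₂-sub-emb₂ σ (conclusion r)))
        (pres (proj₂ ∘ σ)
          (All.map (λ {α} → subst S₂.Designated (proj₂-sub-emb₂ σ α)) (map⁻ hs)))

    emb₁-isApp-holds₂ : ∀ {φ} → IsApp φ → ∀ σ → Holds₂ (sub σ (emb₁ φ))
    emb₁-isApp-holds₂ (app {n} c φs) σ = S₂.⊤^-designated n _

    emb₂-isApp-holds₁ : ∀ {φ} → IsApp φ → ∀ σ → Holds₁ (sub σ (emb₂ φ))
    emb₂-isApp-holds₁ (app {n} c φs) σ = S₁.⊤^-designated n _

    from₁-preserves : ∀ {r} → Tagged L₁.Δ r → Preserves Holds (embRule₁ r)
    from₁-preserves {r} t σ hs =
      embRule₁-preserves {r} (Tagged-preserves {P = S₁.Designated} S₁.rule-preserves t)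
        σ (All.map Product.proj₁ hs) ,
      emb₁-isApp-holds₂ (Tagged-conclusion-isApp t) σ

    from₂-preserves : ∀ {r} → Tagged L₂.Δ r → Preserves Holds (embRule₂ r)
    from₂-preserves {r} t σ hs =
      emb₂-isApp-holds₁ (Tagged-conclusion-isApp t) σ ,
      embRule₂-preserves {r} (Tagged-preserves {P = S₂.Designated} S₂.rule-preserves t)
        σ (All.map Product.proj₂ hs)

    lift-preserves : ∀ φ → Preserves Holds ((emb₁ (proj₁ φ) ∷ emb₂ (proj₂ φ) ∷ []) / φ)
    lift-preserves φ σ ((h₁ , _) ∷ (_ , h₂) ∷ []) =
      subst S₁.Designated (proj₁-sub-emb₁-proj₁ σ φ) h₁ ,
      subst S₂.Designated (proj₂-sub-emb₂-proj₂ σ φ) h₂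

    colift₁-preserves : ∀ φ → Preserves Holds ((φ ∷ []) / emb₁ (proj₁ φ))
    colift₁-preserves (var i)            σ (h ∷ [])        = h
    colift₁-preserves φ@(app (c , _) φs) σ ((h₁ , _) ∷ []) =
      subst S₁.Designated (sym (proj₁-sub-emb₁-proj₁ σ φ)) h₁ ,
      emb₁-isApp-holds₂ (app c (projs₁ φs)) σ

    colift₂-preserves : ∀ φ → Preserves Holds ((φ ∷ []) / emb₂ (proj₂ φ))
    colift₂-preserves (var i)            σ (h ∷ [])        = h
    colift₂-preserves φ@(app (_ , c) φs) σ ((_ , h₂) ∷ []) =
      emb₂-isApp-holds₁ (app c (projs₂ φs)) σ ,
      subst S₂.Designated (sym (proj₂-sub-emb₂-proj₂ σ φ)) h₂

    ¬holds₁-⊥₁ : ¬ Holds₁ ⊥₁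
    ¬holds₁-⊥₁ = L₁.⊥-undist M₁ m₁

    ¬holds₂-⊥₂ : ¬ Holds₂ ⊥₂
    ¬holds₂-⊥₂ = L₂.⊥-undist M₂ m₂

    Δ₁₂-preserves : ∀ {r} → Δ₁₂ r → Preserves Holds r
    Δ₁₂-preserves (from₁ t)   = from₁-preserves t
    Δ₁₂-preserves (from₂ t)   = from₂-preserves t
    Δ₁₂-preserves (lift φ)    = lift-preserves φ
    Δ₁₂-preserves (colift₁ φ) = colift₁-preserves φ
    Δ₁₂-preserves (colift₂ φ) = colift₂-preserves φ
    Δ₁₂-preserves ⊥₁/⊥₂ σ ((h₁ , _) ∷ []) = ⊥-elim (¬holds₁-⊥₁ h₁)
    Δ₁₂-preserves ⊥₂/⊥₁ σ ((_ , h₂) ∷ []) = ⊥-elim (¬holds₂-⊥₂ h₂)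

    ⊢₁₂-sound : ∀ {Γ φ} → Γ ⊢₁₂ φ → Γ ⊆ Holds → Holds φ
    ⊢₁₂-sound d Γ⊆Holds = derivable-preserves Δ₁₂-preserves Γ⊆Holds d

proposition3p2 : (L₁ L₂ : Logic) → Sound L₁ → Sound L₂ →
    let open MeetCombination L₁ L₂
        open MeetCombinationRules L₁ L₂
    in (¬ (∅ ⊢₁₂ ⊥₁)) × (¬ (∅ ⊢₁₂ ⊥₂)) × ((i : ℕ) → ¬ (∅ ⊢₁₂ var i))
proposition3p2 L₁ L₂ sound₁ sound₂ =
  (λ ⊢⊥₁ → ¬holds₁-⊥₁ (Product.proj₁ (⊢-holds ⊢⊥₁))) ,
  (λ ⊢⊥₂ → ¬holds₂-⊥₂ (Product.proj₂ (⊢-holds ⊢⊥₂))) ,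
  (λ i ⊢ξ → ¬holds₁-⊥₁ (Product.proj₁ (⊢-holds ⊢ξ)))
  where
  open MeetCombinationRules L₁ L₂ using (_⊢₁₂_)
  module L₁ = Logic L₁
  module L₂ = Logic L₂
  M₁ : Matrix L₁.Σc
  M₁ = Product.proj₁ L₁.𝓜-nonempty
  M₂ : Matrix L₂.Σc
  M₂ = Product.proj₁ L₂.𝓜-nonempty
  -- Valuating every schema variable at ⊥ makes each ξ as undesignated as ⊥₁.
  open MeetCombinationSoundness.Semantics L₁ L₂ sound₁ sound₂
         (Product.proj₂ L₁.𝓜-nonempty) (Product.proj₂ L₂.𝓜-nonempty)
         (const (Matrix.op M₁ L₁.⊥c [])) (const (Matrix.op M₂ L₂.⊥c []))

  ⊢-holds : ∀ {φ} → ∅ ⊢₁₂ φ → Holds φ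
  ⊢-holds d = ⊢₁₂-sound d (λ ())
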